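{- Let $\alpha$ be a $\mathfrak{Q}$-preorder on a $\mathfrak{Q}$-subset $(X,|\cdot|)$. (1) If $(X,|\cdot|')$ is another $\mathfrak{Q}$-subset (same underlying set) with $|x|\le|x|'\le\alpha(x,x)$ for all $x\in X$, then $\alpha$ is also a $\mathfrak{Q}$-preorder on $(X,|\cdot|')$. (2) If $\mathfrak{Q}$ is integral (i.e. $e=\top$), then $\alpha(x,x)=|x|$ for each $x\in X$.
   Context: $(\mathfrak{Q},\&,e)$ is a unital quantale (complete lattice with an associative multiplication $\&$ with unit $e$, distributing over arbitrary joins in each variable), assumed non-trivial ($\bot<e$). Implications: $p\& q\le r\iff p\le r/q\iff q\le p\backslash r$. A $\mathfrak{Q}$-subset is a set $X$ with a map $|\cdot|\colon X\to\mathfrak{Q}$. A $\mathfrak{Q}$-preorder on a $\mathfrak{Q}$-subset $(X,|\cdot|)$ is a map $\alpha\colon X\times X\to\mathfrak{Q}$ such that for all $x,y,z\in X$: (a) $(\alpha(x,y)/|x|)\&|x|=\alpha(x,y)=|y|\&(|y|\backslash\alpha(x,y))$; (b) $|x|\le\alpha(x,x)$; (c) $(\alpha(y,z)/|y|)\&\alpha(x,y)=\alpha(y,z)\&(|y|\backslash\alpha(x,y))\le\alpha(x,z)$. -}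

module Defs where

open import Data.Product using (Σ; _×_; proj₁; _,_)
open import Data.Empty using (⊥)
open import Relation.Nullary using (¬_)
open import Relation.Binary.PropositionalEquality using (_≡_)

record Quantale : Set₁ where
  infixl 7 _&_
  infix 4 _≤_
  field
    Carrier   : Set
    _≤_       : Carrier → Carrier → Set
    ≤-refl    : ∀ {p} → p ≤ p
    ≤-trans   : ∀ {p q r} → p ≤ q → q ≤ r → p ≤ r
    ≤-antisym : ∀ {p q} → p ≤ q → q ≤ p → p ≡ q
    ⋁         : {I : Set} → (I → Carrier) → Carrier
    ⋁-upper   : {I : Set} (f : I → Carrier) (i : I) → f i ≤ ⋁ f
    ⋁-least   : {I : Set} (f : I → Carrier) (u : Carrier) →
                (∀ i → f i ≤ u) → ⋁ f ≤ u
    _&_       : Carrier → Carrier → Carrier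
    e         : Carrier
    &-assoc   : ∀ p q r → (p & q) & r ≡ p & (q & r)
    &-identityˡ : ∀ p → e & p ≡ p
    &-identityʳ : ∀ p → p & e ≡ p
    &-distribˡ-⋁ : ∀ p {I : Set} (f : I → Carrier) → p & ⋁ f ≡ ⋁ (λ i → p & f i)
    &-distribʳ-⋁ : ∀ p {I : Set} (f : I → Carrier) → ⋁ f & p ≡ ⋁ (λ i → f i & p)

  ⊥q : Carrier
  ⊥q = ⋁ {⊥} (λ ())

  ⊤q : Carrier
  ⊤q = ⋁ {Carrier} (λ p → p)

  -- the implications, defined as the largest solutions of the adjunctions:
  -- p & q ≤ r  iff  p ≤ r / q ;   q & p ≤ r  iff ... i.e.
  -- p & q ≤ r  iff  q ≤ p \ r
  infixl 8 _/_ _\\_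
  _/_ : Carrier → Carrier → Carrier
  r / q = ⋁ {Σ Carrier (λ p → p & q ≤ r)} proj₁

  _\\_ : Carrier → Carrier → Carrier
  p \\ r = ⋁ {Σ Carrier (λ q → p & q ≤ r)} proj₁

-- standing assumption: non-trivial, ⊥ < e  (⊥ ≤ e always holds)
NonTrivial : Quantale → Set
NonTrivial 𝔔 = ¬ (e ≡ ⊥q)
  where open Quantale 𝔔

Integral : Quantale → Set
Integral 𝔔 = e ≡ ⊤q
  where open Quantale 𝔔

record IsQPreorder (𝔔 : Quantale) (X : Set) (∣_∣ : X → Quantale.Carrier 𝔔)
                   (α : X → X → Quantale.Carrier 𝔔) : Set where
  open Quantale 𝔔
  field
    cond-a₁ : ∀ x y → (α x y / ∣ x ∣) & ∣ x ∣ ≡ α x y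
    cond-a₂ : ∀ x y → α x y ≡ ∣ y ∣ & (∣ y ∣ \\ α x y)
    cond-b  : ∀ x → ∣ x ∣ ≤ α x x
    cond-c₁ : ∀ x y z → (α y z / ∣ y ∣) & α x y ≡ α y z & (∣ y ∣ \\ α x y)
    cond-c₂ : ∀ x y z → (α y z / ∣ y ∣) & α x y ≤ α x z

-- Transitivity (c) applied with a repeated point shows that the residuals
-- α x y / ∣ x ∣ and ∣ y ∣ \\ α x y only grow when ∣ x ∣ is replaced by any
-- q ≤ α x x; together with ∣ x ∣ ≤ q this squeezes the divisibility
-- conditions (a) for the larger extent.  Then c₁ follows from (a), and c₂
-- from r / q′ ≤ r / q for q ≤ q′.  If e = ⊤, then
-- α x x = (α x x / ∣ x ∣) & ∣ x ∣ ≤ e & ∣ x ∣ = ∣ x ∣.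
module Submission where

open import Defs
open import Data.Bool using (Bool; true; false)
open import Data.Product using (_×_; _,_; proj₁; proj₂)
open import Relation.Binary.Bundles using (Preorder)
open import Relation.Binary.PropositionalEquality
  using (_≡_; refl; sym; cong; subst; isEquivalence)
import Relation.Binary.Reasoning.Preorder as PreorderReasoning

module QuantaleProperties (𝔔 : Quantale) where
  open Quantale 𝔔

  ≤-reflexive : ∀ {p q} → p ≡ q → p ≤ q
  ≤-reflexive refl = ≤-refl

  ≤-preorder : Preorder _ _ _
  ≤-preorder = record
    { Carrier = Carrier ; _≈_ = _≡_ ; _≲_ = _≤_
    ; isPreorder = record
      { isEquivalence = isEquivalence ; reflexive = ≤-reflexive ; trans = ≤-trans } }

  open PreorderReasoning ≤-preorder public

  ≤-⊤ : ∀ p → p ≤ ⊤q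
  ≤-⊤ p = ⋁-upper (λ q → q) p

  private
    -- The binary join p ∨ q as a Bool-indexed ⋁.
    pair : Carrier → Carrier → Bool → Carrier
    pair p q true  = p
    pair p q false = q

    ⋁-pair : ∀ {p q} → p ≤ q → ⋁ (pair p q) ≡ q
    ⋁-pair {p} {q} p≤q = ≤-antisym
      (⋁-least _ q λ { true → p≤q ; false → ≤-refl })
      (⋁-upper (pair p q) false)

  &-monoˡ-≤ : ∀ r {p q} → p ≤ q → p & r ≤ q & r
  &-monoˡ-≤ r {p} {q} p≤q = begin
    p & r                    ≲⟨ ⋁-upper (λ i → pair p q i & r) true ⟩
    ⋁ (λ i → pair p q i & r) ≡⟨ &-distribʳ-⋁ r (pair p q) ⟨
    ⋁ (pair p q) & r         ≡⟨ cong (_& r) (⋁-pair p≤q) ⟩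
    q & r                    ∎

  &-monoʳ-≤ : ∀ r {p q} → p ≤ q → r & p ≤ r & q
  &-monoʳ-≤ r {p} {q} p≤q = begin
    r & p                    ≲⟨ ⋁-upper (λ i → r & pair p q i) true ⟩
    ⋁ (λ i → r & pair p q i) ≡⟨ &-distribˡ-⋁ r (pair p q) ⟨
    r & ⋁ (pair p q)         ≡⟨ cong (r &_) (⋁-pair p≤q) ⟩
    r & q                    ∎

  &-mono-≤ : ∀ {p q r s} → p ≤ q → r ≤ s → p & r ≤ q & s
  &-mono-≤ {q = q} {r} p≤q r≤s = ≤-trans (&-monoˡ-≤ r p≤q) (&-monoʳ-≤ q r≤s)

  /-counit : ∀ r q → (r / q) & q ≤ r
  /-counit r q = subst (_≤ r) (sym (&-distribʳ-⋁ q proj₁)) (⋁-least _ r proj₂)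

  /-intro : ∀ {p q r} → p & q ≤ r → p ≤ r / q
  /-intro {p} p&q≤r = ⋁-upper proj₁ (p , p&q≤r)

  \\-counit : ∀ p r → p & (p \\ r) ≤ r
  \\-counit p r = subst (_≤ r) (sym (&-distribˡ-⋁ p proj₁)) (⋁-least _ r proj₂)

  \\-intro : ∀ {p q r} → p & q ≤ r → q ≤ p \\ r
  \\-intro {q = q} p&q≤r = ⋁-upper proj₁ (q , p&q≤r)

  /-antitoneʳ : ∀ r {q q′} → q ≤ q′ → r / q′ ≤ r / q
  /-antitoneʳ r {q} {q′} q≤q′ = /-intro (begin
    (r / q′) & q  ≲⟨ &-monoʳ-≤ (r / q′) q≤q′ ⟩
    (r / q′) & q′ ≲⟨ /-counit r q′ ⟩
    r             ∎)

module PreorderProperties {𝔔 : Quantale} {X : Set} {∣_∣ : X → Quantale.Carrier 𝔔}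
                          {α : X → X → Quantale.Carrier 𝔔} (isQPreorder : IsQPreorder 𝔔 X ∣_∣ α)
                          where
  open Quantale 𝔔
  open QuantaleProperties 𝔔
  open IsQPreorder isQPreorder

  /∣∣≤/-below-diagonal : ∀ x y {q} → q ≤ α x x → α x y / ∣ x ∣ ≤ α x y / q
  /∣∣≤/-below-diagonal x y {q} q≤αxx = /-intro (begin
    (α x y / ∣ x ∣) & q     ≲⟨ &-monoʳ-≤ _ q≤αxx ⟩
    (α x y / ∣ x ∣) & α x x ≲⟨ cond-c₂ x x y ⟩
    α x y                   ∎)

  \\∣∣≤\\-below-diagonal : ∀ x y {q} → q ≤ α y y → ∣ y ∣ \\ α x y ≤ q \\ α x y
  \\∣∣≤\\-below-diagonal x y {q} q≤αyy = \\-intro (begin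
    q & (∣ y ∣ \\ α x y)     ≲⟨ &-monoˡ-≤ _ q≤αyy ⟩
    α y y & (∣ y ∣ \\ α x y) ≡⟨ cond-c₁ x y y ⟨
    (α y y / ∣ y ∣) & α x y  ≲⟨ cond-c₂ x y y ⟩
    α x y                    ∎)

  /-cancel-extent : ∀ x y {q} → ∣ x ∣ ≤ q → q ≤ α x x → (α x y / q) & q ≡ α x y
  /-cancel-extent x y {q} ∣x∣≤q q≤αxx = ≤-antisym (/-counit _ _) (begin
    α x y                   ≡⟨ cond-a₁ x y ⟨
    (α x y / ∣ x ∣) & ∣ x ∣ ≲⟨ &-mono-≤ (/∣∣≤/-below-diagonal x y q≤αxx) ∣x∣≤q ⟩
    (α x y / q) & q         ∎)

  \\-cancel-extent : ∀ x y {q} → ∣ y ∣ ≤ q → q ≤ α y y → α x y ≡ q & (q \\ α x y)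
  \\-cancel-extent x y {q} ∣y∣≤q q≤αyy = ≤-antisym (begin
    α x y                     ≡⟨ cond-a₂ x y ⟩
    ∣ y ∣ & (∣ y ∣ \\ α x y)  ≲⟨ &-mono-≤ ∣y∣≤q (\\∣∣≤\\-below-diagonal x y q≤αyy) ⟩
    q & (q \\ α x y)          ∎) (\\-counit _ _)

  isQPreorder-larger-extent : (∣_∣′ : X → Carrier) → (∀ x → ∣ x ∣ ≤ ∣ x ∣′ × ∣ x ∣′ ≤ α x x) →
                        IsQPreorder 𝔔 X ∣_∣′ α
  isQPreorder-larger-extent ∣_∣′ between = record
    { cond-a₁ = a₁
    ; cond-a₂ = a₂
    ; cond-b  = λ x → proj₂ (between x)
    ; cond-c₁ = c₁
    ; cond-c₂ = λ x y z → ≤-trans (&-monoˡ-≤ (α x y) (/-antitoneʳ (α y z) (proj₁ (between y))))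
                                  (cond-c₂ x y z)
    }
    where
    a₁ : ∀ x y → (α x y / ∣ x ∣′) & ∣ x ∣′ ≡ α x y
    a₁ x y = /-cancel-extent x y (proj₁ (between x)) (proj₂ (between x))

    a₂ : ∀ x y → α x y ≡ ∣ y ∣′ & (∣ y ∣′ \\ α x y)
    a₂ x y = \\-cancel-extent x y (proj₁ (between y)) (proj₂ (between y))

    c₁ : ∀ x y z → (α y z / ∣ y ∣′) & α x y ≡ α y z & (∣ y ∣′ \\ α x y)
    c₁ x y z = begin-equality
      (α y z / ∣ y ∣′) & α x y                          ≡⟨ cong (α y z / ∣ y ∣′ &_) (a₂ x y) ⟩
      (α y z / ∣ y ∣′) & (∣ y ∣′ & (∣ y ∣′ \\ α x y))  ≡⟨ &-assoc _ _ _ ⟨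
      ((α y z / ∣ y ∣′) & ∣ y ∣′) & (∣ y ∣′ \\ α x y)  ≡⟨ cong (_& (∣ y ∣′ \\ α x y)) (a₁ y z) ⟩
      α y z & (∣ y ∣′ \\ α x y)                        ∎

  α-diagonal-integral : Integral 𝔔 → ∀ x → α x x ≡ ∣ x ∣
  α-diagonal-integral e≡⊤ x = ≤-antisym (begin
    α x x                   ≡⟨ cond-a₁ x x ⟨
    (α x x / ∣ x ∣) & ∣ x ∣ ≲⟨ &-monoˡ-≤ ∣ x ∣ (≤-⊤ _) ⟩
    ⊤q & ∣ x ∣              ≡⟨ cong (_& ∣ x ∣) e≡⊤ ⟨
    e & ∣ x ∣               ≡⟨ &-identityˡ ∣ x ∣ ⟩
    ∣ x ∣                   ∎) (cond-b x)

proposition3p3 : (𝔔 : Quantale) → NonTrivial 𝔔 →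
    (X : Set) (∣_∣ : X → Quantale.Carrier 𝔔) (α : X → X → Quantale.Carrier 𝔔) →
    IsQPreorder 𝔔 X ∣_∣ α →
    ((∣_∣′ : X → Quantale.Carrier 𝔔) →
       (∀ x → Quantale._≤_ 𝔔 ∣ x ∣ (∣_∣′ x) × Quantale._≤_ 𝔔 (∣_∣′ x) (α x x)) →
       IsQPreorder 𝔔 X ∣_∣′ α)
    × (Integral 𝔔 → ∀ x → α x x ≡ ∣ x ∣)
proposition3p3 𝔔 _ X ∣_∣ α isQPreorder = isQPreorder-larger-extent , α-diagonal-integral
  where open PreorderProperties isQPreorder
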